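{- Let $\mathcal{H}$ be an $r$-partite $r$-graph with vertex parts $V_1,\dots,V_r$, and let $t$ be a positive integer. If $\mathcal{H}$ is $\mathscr{G}_r(tr-r,\,t)$-free, then for any $t$ distinct edges $A_1,\dots,A_t$ of $\mathcal{H}$ there exists $1\le i\le r$ such that the $t$ vertices $A_1\cap V_i,\dots,A_t\cap V_i$ are pairwise distinct.
   Context: An $r$-graph is a family of distinct $r$-element subsets (edges) of a finite vertex set. It is $r$-partite with vertex parts $V_1,\dots,V_r$ if these are pairwise disjoint sets partitioning the vertex set with $|A\cap V_i|=1$ for every edge $A$ and every $i$ (so $A\cap V_i$ is identified with a single vertex). For integers $v,e$, an $r$-graph is $\mathscr{G}_r(v,e)$-free if the union of any $e$ distinct edges contains at least $v+1$ vertices. -}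

module Defs where

open import Data.Nat using (ℕ; _+_; _≤_)
open import Data.Fin using (Fin)
open import Data.Fin.Properties using () renaming (_≟_ to _≟ᶠ_)
open import Data.Nat.Properties using () renaming (_≟_ to _≟ⁿ_)
open import Data.Product using (_×_; _,_)
open import Data.Product.Properties using (≡-dec)
open import Data.List using (List; map; concatMap; length; deduplicate; allFin)
open import Data.List.Membership.Propositional using (_∈_)
open import Relation.Binary.PropositionalEquality using (_≡_)
open import Relation.Nullary using (Dec)
open import Function.Definitions using (Injective)

-- An r-partite r-graph with vertex parts V_1,…,V_r.
-- Vertices are pairs (i , x): vertex x of part V_i (parts are disjoint by construction).
Vertex : ℕ → Set
Vertex r = Fin r × ℕ

-- An edge of an r-partite r-graph is determined by choosing one vertex in each part:
-- A i is the vertex A ∩ V_i.  Its vertex set is {(i , A i) | i ∈ Fin r}.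
Edge : ℕ → Set
Edge r = Fin r → ℕ

edgeVertices : ∀ {r} → Edge r → List (Vertex r)
edgeVertices {r} A = map (λ i → (i , A i)) (allFin r)

Graph : ℕ → Set
Graph r = List (Edge r)

_≟ᵛ_ : ∀ {r} (x y : Vertex r) → Dec (x ≡ y)
_≟ᵛ_ = ≡-dec _≟ᶠ_ _≟ⁿ_

unionSize : ∀ {r e} → (Fin e → Edge r) → ℕ
unionSize {r} {e} B = length (deduplicate _≟ᵛ_ (concatMap (λ j → edgeVertices (B j)) (allFin e)))

GFree : ∀ {r} → ℕ → ℕ → Graph r → Set
GFree {r} v e H =
  (B : Fin e → Edge r) → Injective _≡_ _≡_ B → (∀ j → B j ∈ H) → v + 1 ≤ unionSize B

module Submission where

-- Call a map f : Fin t → ℕ *colliding* if f j ≡ f k for some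
-- j ≢ k.  Suppose, for contradiction, that every column  j ↦ A j i  of the t
-- given edges is colliding.  A colliding map on Fin (suc n) takes at most n
-- distinct values: if f j ≡ f k with j ≢ k, every value of f is already a
-- value of  f ∘ punchIn k.  Hence the part V_i contains at most t - 1
-- vertices of the union of the edges, and the union has at most r (t - 1)
-- vertices.  Being G_r(tr - r, t)-free demands at least tr - r + 1 vertices,
-- a contradiction.  Since collisions are decidable, some column is therefore
-- not colliding, i.e. injective, which is the claim.

open import Defs
open import Data.Nat using (ℕ; suc; _*_; _∸_; _≤_; _+_; s≤s; z≤n)
open import Data.Nat.Properties using (m+n∸m≡n; *-comm; +-comm; ≤-trans; 1+n≰n)
  renaming (_≟_ to _≟ⁿ_)
open import Data.Fin using (Fin; zero; suc; punchIn; punchOut)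
open import Data.Fin.Properties using (any?; all?; ¬∀⟶∃¬; injective⇒≤; punchIn-punchOut)
  renaming (_≟_ to _≟ᶠ_)
open import Data.Product using (∃; ∃₂; _×_; _,_; proj₁; proj₂)
open import Data.List using (List; []; _∷_; map; concatMap; length; lookup; deduplicate; allFin)
open import Data.List.Properties using (length-++; length-map; length-tabulate)
open import Data.List.Membership.Propositional using (_∈_)
open import Data.List.Membership.Propositional.Properties
  using (∈-lookup; ∈-map⁺; ∈-map⁻; ∈-concatMap⁺; ∈-concatMap⁻; ∈-allFin; ∈-deduplicate⁻)
import Data.List.Membership.Setoid.Properties as SetoidMembership
open import Data.List.Relation.Unary.Any using (index; satisfied)
import Data.List.Relation.Unary.Any as Any
import Data.List.Relation.Unary.All as All
open import Data.List.Relation.Unary.AllPairs using (_∷_)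
open import Data.List.Relation.Unary.Unique.Propositional using (Unique)
open import Data.List.Relation.Unary.Unique.DecPropositional.Properties using (deduplicate-!)
open import Relation.Binary.PropositionalEquality
  using (_≡_; _≢_; refl; sym; trans; cong; cong₂; subst; setoid; ≢-sym; module ≡-Reasoning)
open ≡-Reasoning
open import Relation.Nullary using (Dec; yes; no; ¬_; ¬?; contradiction)
open import Relation.Nullary.Decidable using (_×-dec_)
open import Function.Base using (id)
open import Function.Definitions using (Injective)

lookup-injective : ∀ {X : Set} {xs : List X} → Unique xs → Injective _≡_ _≡_ (lookup xs)
lookup-injective {xs = _ ∷ _} _ {zero} {zero} _ = refl
lookup-injective {xs = _ ∷ _} (x∉xs ∷ _) {zero} {suc j} x≡xⱼ =
  contradiction x≡xⱼ (All.lookup x∉xs (∈-lookup j))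
lookup-injective {xs = _ ∷ _} (x∉xs ∷ _) {suc i} {zero} xᵢ≡x =
  contradiction (sym xᵢ≡x) (All.lookup x∉xs (∈-lookup i))
lookup-injective {xs = _ ∷ _} (_ ∷ unique) {suc i} {suc j} eq =
  cong suc (lookup-injective unique eq)

-- A duplicate-free list contained in ys is no longer than ys: sending each
-- position of xs to the position of its entry in ys is injective.
unique-⊆-length : ∀ {X : Set} {xs ys : List X} →
  Unique xs → (∀ {z} → z ∈ xs → z ∈ ys) → length xs ≤ length ys
unique-⊆-length {xs = xs} {ys} unique xs⊆ys = injective⇒≤ positionInYs-injective
  where
  positionInYs : Fin (length xs) → Fin (length ys)
  positionInYs i = index (xs⊆ys (∈-lookup i))

  positionInYs-injective : Injective _≡_ _≡_ positionInYs
  positionInYs-injective eq = lookup-injective unique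
    (SetoidMembership.index-injective (setoid _) (xs⊆ys (∈-lookup _)) (xs⊆ys (∈-lookup _)) eq)

length-allFin : ∀ n → length (allFin n) ≡ n
length-allFin n = length-tabulate id

length-concatMap-const : ∀ {X Y : Set} (L : X → List Y) (c : ℕ) →
  (∀ x → length (L x) ≡ c) → (xs : List X) → length (concatMap L xs) ≡ length xs * c
length-concatMap-const L c _ [] = refl
length-concatMap-const L c len (x ∷ xs) =
  trans (length-++ (L x)) (cong₂ _+_ (len x) (length-concatMap-const L c len xs))

Colliding : ∀ {X : Set} {n} → (Fin n → X) → Set
Colliding f = ∃₂ λ j k → j ≢ k × f j ≡ f k

colliding? : ∀ {n} (f : Fin n → ℕ) → Dec (Colliding f)
colliding? f = any? λ j → any? λ k → ¬? (j ≟ᶠ k) ×-dec (f j ≟ⁿ f k)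

¬colliding⇒injective : ∀ {X : Set} {n} (f : Fin n → X) → ¬ Colliding f → Injective _≡_ _≡_ f
¬colliding⇒injective f noCollision {j} {k} fj≡fk with j ≟ᶠ k
... | yes j≡k = j≡k
... | no  j≢k = contradiction (j , k , j≢k , fj≡fk) noCollision

punchIn-onto : ∀ {n} (k y : Fin (suc n)) → y ≢ k → ∃ λ m → punchIn k m ≡ y
punchIn-onto k y y≢k = punchOut (≢-sym y≢k) , punchIn-punchOut (≢-sym y≢k)

colliding-values : ∀ {X : Set} {n} (f : Fin (suc n) → X) {j k} → j ≢ k → f j ≡ f k →
  ∀ x → ∃ λ m → f x ≡ f (punchIn k m)
colliding-values f {j} {k} j≢k fj≡fk x with x ≟ᶠ k
... | no  x≢k  with m , punchIn≡x ← punchIn-onto k x x≢k = m , cong f (sym punchIn≡x)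
... | yes refl with m , punchIn≡j ← punchIn-onto k j j≢k = m , trans (sym fj≡fk) (cong f (sym punchIn≡j))

unionVertices : ∀ {r e} → (Fin e → Edge r) → List (Vertex r)
unionVertices {e = e} B = concatMap (λ j → edgeVertices (B j)) (allFin e)

∈-unionVertices⁻ : ∀ {r e} (B : Fin e → Edge r) {z} → z ∈ unionVertices B →
  ∃₂ λ i j → z ≡ (i , B j i)
∈-unionVertices⁻ {e = e} B z∈union
  with j , z∈Bj ← satisfied (∈-concatMap⁻ (λ j → edgeVertices (B j)) {xs = allFin e} z∈union)
  with i , _ , z≡ ← ∈-map⁻ (λ i → (i , B j i)) z∈Bj
  = i , j , z≡

-- If every column of n + 1 edges is colliding, each part meets their union
-- in at most n vertices, so the union has at most r * n vertices.
unionSize-colliding : ∀ {r n} (B : Fin (suc n) → Edge r) →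
  (∀ i → Colliding (λ j → B j i)) → unionSize B ≤ r * n
unionSize-colliding {r} {n} B colliding =
  subst (unionSize B ≤_) length-reduced
    (unique-⊆-length (deduplicate-! _≟ᵛ_ (unionVertices B)) covered)
  where
  -- an argument deleted from column i without losing a value
  deleted : Fin r → Fin (suc n)
  deleted i = proj₁ (proj₂ (colliding i))

  -- the vertices of part i, read off from the n edges other than the deleted one
  part : Fin r → List (Vertex r)
  part i = map (λ m → (i , B (punchIn (deleted i) m) i)) (allFin n)

  reduced : List (Vertex r)
  reduced = concatMap part (allFin r)

  length-reduced : length reduced ≡ r * n
  length-reduced = begin
    length reduced              ≡⟨ length-concatMap-const part n length-part (allFin r) ⟩
    length (allFin r) * n       ≡⟨ cong (_* n) (length-allFin r) ⟩
    r * n                       ∎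
    where
    length-part : ∀ i → length (part i) ≡ n
    length-part i = trans (length-map _ (allFin n)) (length-allFin n)

  in-part : ∀ i j → (i , B j i) ∈ part i
  in-part i j = subst (λ v → (i , v) ∈ part i) (sym (proj₂ value)) (∈-map⁺ _ (∈-allFin (proj₁ value)))
    where
    j₁≢j₂ : proj₁ (colliding i) ≢ deleted i
    j₁≢j₂ = proj₁ (proj₂ (proj₂ (colliding i)))
    equal : B (proj₁ (colliding i)) i ≡ B (deleted i) i
    equal = proj₂ (proj₂ (proj₂ (colliding i)))
    value : ∃ λ m → B j i ≡ B (punchIn (deleted i) m) i
    value = colliding-values (λ j → B j i) j₁≢j₂ equal j

  covered : ∀ {z} → z ∈ deduplicate _≟ᵛ_ (unionVertices B) → z ∈ reduced
  covered z∈dedup with i , j , refl ← ∈-unionVertices⁻ B (∈-deduplicate⁻ _≟ᵛ_ _ z∈dedup)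
    = ∈-concatMap⁺ part (Any.map (λ { refl → in-part i j }) (∈-allFin i))

freeness-threshold : ∀ r n → suc n * r ∸ r + 1 ≡ suc (r * n)
freeness-threshold r n = begin
  suc n * r ∸ r + 1   ≡⟨ cong (_+ 1) (m+n∸m≡n r (n * r)) ⟩
  n * r + 1           ≡⟨ +-comm (n * r) 1 ⟩
  suc (n * r)         ≡⟨ cong suc (*-comm n r) ⟩
  suc (r * n)         ∎

lemma6 : (r t : ℕ) (H : Graph r) → 1 ≤ t → GFree (t * r ∸ r) t H →
    (A : Fin t → Edge r) → Injective _≡_ _≡_ A → (∀ j → A j ∈ H) →
    ∃ λ (i : Fin r) → Injective _≡_ _≡_ (λ j → A j i)
lemma6 r (suc n) H (s≤s z≤n) free A A-injective A∈H
  with all? (λ i → colliding? (λ j → A j i))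
... | yes allColliding = contradiction (≤-trans manyVertices fewVertices) 1+n≰n
  where
  manyVertices : suc (r * n) ≤ unionSize A
  manyVertices = subst (_≤ unionSize A) (freeness-threshold r n) (free A A-injective A∈H)
  fewVertices : unionSize A ≤ r * n
  fewVertices = unionSize-colliding A allColliding
... | no notAllColliding
  with i , notColliding ← ¬∀⟶∃¬ r _ (λ i → colliding? (λ j → A j i)) notAllColliding
  = i , ¬colliding⇒injective (λ j → A j i) notColliding
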